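{- Assume the Axiom of Choice. Let $A$ be an infinite set of prisoners, $K$ any set of colors with $|K|\ge2$, $V$ a visibility graph on $A$, and $I$ an inning function on $A$ with $IN\ge2$, such that the hat game $\mathcal{G}=(A,K,V,I)$ satisfies (S1) $|I_1|=1$, and (S2) for every $a\in A$, $V(a)\cup H(a)=A\setminus\{a\}$. Then there is a predictor for $\mathcal{G}$ under which, for every coloring $f\in K^A$, at most one prisoner guesses incorrectly.
   Context: A hat game $(A,K,V,I)$ consists of: a set $A$ of prisoners and a set $K$ of colors (with $|A|,|K|\ge2$); a visibility graph $V\subseteq A^2$ with no loops, where $(a,b)\in V$ means $a$ sees $b$'s hat, and $V(a)=\{b:(a,b)\in V\}$; and an inning function $I$, a surjection from $A$ onto $\{\beta:1\le\beta\le\alpha\}$ for some nonzero ordinal $\alpha$. Write $IN=\max\operatorname{ran}(I)$, $I_\beta=\{a:I(a)=\beta\}$, and $H(a)=\{b:I(b)<I(a)\}$. A coloring is $f\in K^A$. Strategies: for each $a$, a function $S_a:K^{H(a)}\times K^{V(a)}\to K$; guesses are defined by transfinite recursion on $I(a)$ as $\sigma_a(f)=S_a(h_a^f,f\restriction V(a))$ with $h_a^f=(\sigma_b(f))_{b\in H(a)}$. A predictor is $P:K^A\to K^A$ with $P(f)(a)=\sigma_a(f)$ for some family of strategies. Prisoner $a$ guesses incorrectly under $f$ if $P(f)(a)\ne f(a)$. -}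

module Defs where

open import Data.Bool using (Bool; true; false)
open import Data.Nat using (ℕ)
open import Data.Fin using (Fin)
open import Data.Product using (Σ; _×_; _,_)
open import Data.Sum using (_⊎_)
open import Relation.Nullary using (¬_; Dec)
open import Relation.Binary.PropositionalEquality using (_≡_; _≢_)
open import Relation.Binary.Structures using (IsStrictTotalOrder)
open import Induction.WellFounded using (WellFounded)
open import Function.Bundles using (_↔_)

-- The Axiom of Choice (classical ZFC background), rendered as:
-- excluded middle plus the well-ordering principle (equivalent to AC).

ExcludedMiddle : Set₁
ExcludedMiddle = (P : Set) → Dec P

WellOrderingPrinciple : Set₁
WellOrderingPrinciple =
  (X : Set) → Σ (X → X → Set) λ _<_ →
    IsStrictTotalOrder _≡_ _<_ × WellFounded _<_

AxiomOfChoice : Set₁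
AxiomOfChoice = ExcludedMiddle × WellOrderingPrinciple

Infinite : Set → Set
Infinite X = ¬ (Σ ℕ λ n → X ↔ Fin n)

AtLeastTwo : Set → Set
AtLeastTwo K = Σ K λ k₁ → Σ K λ k₂ → k₁ ≢ k₂

-- Inning functions: a surjection I : A → O onto a well-ordered set O
-- (any well-order is order-isomorphic to an ordinal segment {1..α});
-- the range has a maximum IN (= α).

record Inning (A : Set) : Set₁ where
  field
    O        : Set
    _<_      : O → O → Set
    isSTO    : IsStrictTotalOrder _≡_ _<_
    wf       : WellFounded _<_
    I        : A → O
    surj     : ∀ o → Σ A λ a → I a ≡ o
    IN       : O
    IN-max   : ∀ o → ¬ (IN < o)

  InFirst : A → Set
  InFirst a = ∀ b → ¬ (I b < I a)

  Heard : A → A → Set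
  Heard a b = I b < I a

module _ {A : Set} (In : Inning A) where
  open Inning In

  AtLeastTwoInnings : Set
  AtLeastTwoInnings = Σ A λ a → Σ A λ b → I a < I b

  S1 : Set
  S1 = Σ A λ a₀ → InFirst a₀ × (∀ b → InFirst b → b ≡ a₀)

  -- (S2) V(a) ∪ H(a) = A ∖ {a}. (The inclusion ⊆ holds automatically since
  -- V has no loops and < is irreflexive; we state both directions.)
  S2 : (V : A → A → Bool) → Set
  S2 V = ∀ a b → (b ≢ a → (V a b ≡ true ⊎ Heard a b))
                × ((V a b ≡ true ⊎ Heard a b) → b ≢ a)

  Strategies : (K : Set) (V : A → A → Bool) → Set
  Strategies K V = (a : A) → ((b : A) → Heard a b → K)
                           → ((b : A) → V a b ≡ true → K) → K

  -- P is a predictor: P(f)(a) = σ_a(f) where σ is given by the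
  -- (well-founded, hence uniquely solvable) recursion
  -- σ_a(f) = S_a((σ_b(f))_{b ∈ H(a)}, f ↾ V(a)).
  IsPredictor : (K : Set) (V : A → A → Bool) → ((A → K) → (A → K)) → Set
  IsPredictor K V P = Σ (Strategies K V) λ S →
    ∀ (f : A → K) (a : A) → P f a ≡ S a (λ b _ → P f b) (λ b _ → f b)

  AtMostOneWrong : (K : Set) → ((A → K) → (A → K)) → Set
  AtMostOneWrong K P = ∀ (f : A → K) (a b : A) → P f a ≢ f a → P f b ≢ f b → a ≡ b

module Submission where

open import Defs
open import Level using (0ℓ)
open import Algebra.Definitions using (RightIdentity; LeftCancellative; RightCancellative)
open import Data.Bool using (Bool; true; false) renaming (_≟_ to _≟ᵇ_)
open import Data.Empty using (⊥-elim)
open import Data.Fin using (Fin; toℕ)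
open import Data.Fin.Properties using (toℕ-injective; toℕ<n; toℕ-fromℕ<)
open import Data.List using (List; []; _∷_; _++_; foldl; foldr; filter; map; upTo; lookup; length; deduplicate)
open import Data.List.Membership.Propositional using (_∈_)
open import Data.List.Membership.Propositional.Properties
  using (∈-deduplicate⁺; ∈-lookup; ∈-map⁺; ∈-upTo⁺; ∈-filter⁺; ∈-filter⁻; ∈-++⁺ˡ; ∈-++⁺ʳ)
open import Data.List.Membership.Propositional.Properties.WithK using (unique⇒irrelevant)
open import Data.List.Relation.Unary.All as All using (All; []; _∷_)
open import Data.List.Relation.Unary.AllPairs as AllPairs using (AllPairs; []; _∷_)
import Data.List.Relation.Unary.AllPairs.Properties as AllPairsₚ
open import Data.List.Relation.Unary.Any using (index; here; there)
open import Data.List.Relation.Unary.Any.Properties using (lookup-index)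
import Data.List.Relation.Unary.Unique.DecPropositional.Properties as Uniqueₚ
open import Data.Nat using (ℕ; zero; suc; _+_; _*_; _∸_; _≤_; s<s) renaming (_<_ to _<ℕ_)
open import Data.Nat.DivMod using (_%_; _mod_; %-distribˡ-+; [m+n]%n≡m%n; m<n⇒m%n≡m; m%n<n)
open import Data.Nat.Induction using (<-wellFounded)
open import Data.Nat.Properties
  using ( +-assoc; +-comm; +-identityʳ; m∸n+n≡m; <⇒≤; <-isStrictTotalOrder
        ; even≢odd; *-cancelˡ-≡; *-monoʳ-<; suc-injective)
open import Data.Product using (Σ; ∃; _×_; _,_; proj₁; proj₂)
open import Data.Product.Relation.Binary.Lex.Strict using (×-Lex; ×-wellFounded; ×-isStrictTotalOrder)
open import Data.Product.Relation.Binary.Pointwise.NonDependent using (≡×≡⇒≡; ≡⇒≡×≡)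
open import Data.Sum using (_⊎_; inj₁; inj₂)
open import Data.Unit using (⊤; tt)
open import Function using (_∘_; _$_)
open import Function.Bundles using (_↔_; Inverse; mk↔ₛ′)
open import Function.Definitions using (Injective)
open import Induction.WellFounded using (WellFounded; WfRec; Acc; acc)
import Induction.WellFounded as WF
import Relation.Binary.Construct.On as On
open import Relation.Binary.Consequences using (tri⇒irr)
open import Relation.Binary.Core using (Rel)
open import Relation.Binary.Definitions using (DecidableEquality; Trichotomous; Tri; tri<; tri≈; tri>)
open import Relation.Binary.PropositionalEquality
  using (_≡_; _≢_; _≗_; refl; sym; trans; cong; cong₂; subst; module ≡-Reasoning)
open import Relation.Binary.Structures using (IsStrictTotalOrder)
open import Relation.Nullary using (¬_; ¬?; Dec; yes; no; contradiction)
open import Relation.Unary using (Pred; Decidable; ∁; _≐_; _⟨⊎⟩_)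

-- Prisoner a₀, alone in the first inning, sees everybody else (S2), and every other prisoner
-- hears a₀'s guess (S1) and sees or hears the correct guesses of everybody except himself and
-- a₀. So it suffices to have a colouring c : K^A → K that ignores the hat of a₀ and separates
-- any two hat assignments differing at exactly one other prisoner: a₀ announces c(f), and every
-- a ≠ a₀ finds his colour as the unique k with c(f[a ≔ k]) = c(f).
--
-- Such a c is a proper K-colouring of the Hamming graph on K^A. With choice, pick a
-- representative r of every class of assignments modulo finite change, a well-order of A, and a
-- cancellative magma (K, ∙, ε) with right identity: addition modulo n if |K| = n, and for
-- infinite K the transfinite "mex" Latin square x ∙ y = least element different from all
-- x' ∙ y (x' < x) and x ∙ y' (y' < y), along a well-order of K in which any two initial segments
-- together are smaller than K. Then c(f) is the product, in increasing order of x, of the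
-- elements swap(r x, ε)(f x) over the finitely many x with f x ≠ r x; changing f at one point
-- changes exactly one factor, and a cancellative product notices.

index-∈-lookup : {X : Set} (xs : List X) (i : Fin (length xs)) → index (∈-lookup {xs = xs} i) ≡ i
index-∈-lookup (x ∷ xs) Fin.zero = refl
index-∈-lookup (x ∷ xs) (Fin.suc i) = cong Fin.suc (index-∈-lookup xs i)

module Classical (em : ExcludedMiddle) where

  dne : {P : Set} → ¬ ¬ P → P
  dne {P} ¬¬p with em P
  ... | yes p = p
  ... | no ¬p = contradiction ¬p ¬¬p

  _≟_ : {X : Set} → DecidableEquality X
  x ≟ y = em (x ≡ y)

  choose : {X : Set} → X → Pred X 0ℓ → X
  choose x₀ Q with em (∃ Q)
  ... | yes (x , _) = x
  ... | no _ = x₀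

  choose-spec : {X : Set} (x₀ : X) {Q : Pred X 0ℓ} → ∃ Q → Q (choose x₀ Q)
  choose-spec x₀ {Q} ∃q with em (∃ Q)
  ... | yes (_ , q) = q
  ... | no ∄q = contradiction ∃q ∄q

  _[_≔_] : {X K : Set} → (X → K) → X → K → X → K
  (f [ x ≔ k ]) z with z ≟ x
  ... | yes _ = k
  ... | no _ = f z

  [≔]-updated : {X K : Set} (f : X → K) (x : X) (k : K) → (f [ x ≔ k ]) x ≡ k
  [≔]-updated f x k with x ≟ x
  ... | yes _ = refl
  ... | no x≢x = contradiction refl x≢x

  [≔]-other : {X K : Set} (f : X → K) {x z : X} (k : K) → z ≢ x → (f [ x ≔ k ]) z ≡ f z
  [≔]-other f {x} {z} k z≢x with z ≟ x
  ... | yes z≡x = contradiction z≡x z≢x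
  ... | no _ = refl

  [≔]-restore : {X K : Set} {f g : X → K} (x z : X) → (z ≢ x → f z ≡ g z) → (f [ x ≔ g x ]) z ≡ g z
  [≔]-restore x z agree with z ≟ x
  ... | yes refl = refl
  ... | no z≢x = agree z≢x

  transpose : {X : Set} → X → X → X → X
  transpose a b c with c ≟ a | c ≟ b
  ... | yes _ | _ = b
  ... | no _ | yes _ = a
  ... | no _ | no _ = c

  transpose-self : {X : Set} (a b : X) → transpose a b a ≡ b
  transpose-self a b with a ≟ a
  ... | yes _ = refl
  ... | no a≢a = contradiction refl a≢a

  transpose-other : {X : Set} (a b : X) → transpose a b b ≡ a
  transpose-other a b with b ≟ a | b ≟ b
  ... | yes b≡a | _ = b≡a
  ... | no _ | yes _ = refl
  ... | no _ | no b≢b = contradiction refl b≢b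

  transpose-fixed : {X : Set} {a b c : X} → c ≢ a → c ≢ b → transpose a b c ≡ c
  transpose-fixed {a = a} {b} {c} c≢a c≢b with c ≟ a | c ≟ b
  ... | yes c≡a | _ = contradiction c≡a c≢a
  ... | no _ | yes c≡b = contradiction c≡b c≢b
  ... | no _ | no _ = refl

  transpose-involutive : {X : Set} (a b c : X) → transpose a b (transpose a b c) ≡ c
  transpose-involutive a b c = cases (c ≟ a) (c ≟ b)
    where
    open ≡-Reasoning
    cases : Dec (c ≡ a) → Dec (c ≡ b) → transpose a b (transpose a b c) ≡ c
    cases (yes c≡a) _ = begin
      transpose a b (transpose a b c)  ≡⟨ cong (λ x → transpose a b (transpose a b x)) c≡a ⟩
      transpose a b (transpose a b a)  ≡⟨ cong (transpose a b) (transpose-self a b) ⟩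
      transpose a b b                  ≡⟨ transpose-other a b ⟩
      a                                ≡⟨ sym c≡a ⟩
      c                                ∎
    cases (no _) (yes c≡b) = begin
      transpose a b (transpose a b c)  ≡⟨ cong (λ x → transpose a b (transpose a b x)) c≡b ⟩
      transpose a b (transpose a b b)  ≡⟨ cong (transpose a b) (transpose-other a b) ⟩
      transpose a b a                  ≡⟨ transpose-self a b ⟩
      b                                ≡⟨ sym c≡b ⟩
      c                                ∎
    cases (no c≢a) (no c≢b) =
      trans (cong (transpose a b) (transpose-fixed c≢a c≢b)) (transpose-fixed c≢a c≢b)

  transpose-injective : {X : Set} (a b : X) {c c' : X} → transpose a b c ≡ transpose a b c' → c ≡ c'
  transpose-injective a b {c} {c'} eq =
    trans (sym (transpose-involutive a b c)) (trans (cong (transpose a b) eq) (transpose-involutive a b c'))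

  enumeration⇒finite : {X : Set} (xs : List X) → (∀ x → x ∈ xs) → ∃ λ n → X ↔ Fin n
  enumeration⇒finite xs enumerates = length ys , mk↔ₛ′ to (lookup ys) to∘lookup lookup∘to
    where
    ys = deduplicate _≟_ xs
    ∈ys : ∀ x → x ∈ ys
    ∈ys x = ∈-deduplicate⁺ _≟_ (enumerates x)
    to : _ → Fin (length ys)
    to x = index (∈ys x)
    lookup∘to : ∀ x → lookup ys (to x) ≡ x
    lookup∘to x = sym (lookup-index (∈ys x))
    to∘lookup : ∀ i → to (lookup ys i) ≡ i
    to∘lookup i = trans (cong index (unique⇒irrelevant (Uniqueₚ.deduplicate-! _≟_ xs) (∈ys _) (∈-lookup i)))
                        (index-∈-lookup ys i)

separated⇒injective : {X Y : Set} {_<_ : Rel X 0ℓ} → Trichotomous _≡_ _<_ → {f : X → Y} →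
                      (∀ {x y} → x < y → f x ≢ f y) → ∀ x y → f x ≡ f y → x ≡ y
separated⇒injective compare separated x y fx≡fy with compare x y
... | tri< x<y _ _ = contradiction fx≡fy (separated x<y)
... | tri≈ _ x≡y _ = x≡y
... | tri> _ _ y<x = contradiction (sym fx≡fy) (separated y<x)

module Least (em : ExcludedMiddle) {X : Set} {_<_ : Rel X 0ℓ}
             (compare : Trichotomous _≡_ _<_) (wf : WellFounded _<_) where
  open Classical em using (dne)

  IsLeast : Pred X 0ℓ → Pred X 0ℓ
  IsLeast Q m = Q m × (∀ {y} → y < m → ¬ Q y)

  least : (Q : Pred X 0ℓ) → ∃ Q → ∃ (IsLeast Q)
  least Q (x , qx) = descend x (wf x) qx
    where
    descend : ∀ x → Acc _<_ x → Q x → ∃ (IsLeast Q)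
    descend x (acc below) qx with em (∃ λ y → y < x × Q y)
    ... | yes (y , y<x , qy) = descend y (below y<x) qy
    ... | no ∄y = x , qx , λ y<x qy → ∄y (_ , y<x , qy)

  least-unique : ∀ {Q Q' m m'} → Q ≐ Q' → IsLeast Q m → IsLeast Q' m' → m ≡ m'
  least-unique {m = m} {m'} (Q⊆Q' , Q'⊆Q) (qm , m-least) (q'm' , m'-least) with compare m m'
  ... | tri< m<m' _ _ = contradiction (Q⊆Q' qm) (m'-least m<m')
  ... | tri≈ _ m≡m' _ = m≡m'
  ... | tri> _ _ m'<m = contradiction (Q'⊆Q q'm') (m-least m'<m)

  mex : (T : Pred X 0ℓ) → ¬ (∀ x → T x) → ∃ (IsLeast (∁ T))
  mex T ¬all = least (∁ T) (dne λ ∄ → ¬all λ x → dne λ ¬Tx → ∄ (x , ¬Tx))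

  mex-cong : ∀ {T T'} (¬all : ¬ (∀ x → T x)) (¬all' : ¬ (∀ x → T' x)) → T ≐ T' →
             proj₁ (mex T ¬all) ≡ proj₁ (mex T' ¬all')
  mex-cong ¬all ¬all' (T⊆T' , T'⊆T) =
    least-unique ((λ ¬t t' → ¬t (T'⊆T t')) , (λ ¬t' t → ¬t' (T⊆T' t)))
                 (proj₂ (mex _ ¬all)) (proj₂ (mex _ ¬all'))

module Smallness (em : ExcludedMiddle) {K : Set} (k₀ : K) where
  open Classical em

  -- |S| < |K|, phrased without cardinals; the hypothesis is about maps defined on all of T so
  -- that no proof-relevant membership in S has to be compared.
  Small : {T : Set} → Pred T 0ℓ → Set
  Small {T} S = ∀ (g : T → K) → ¬ (∀ k → ∃ λ t → S t × g t ≡ k)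

  small-injection : {T U : Set} {S : Pred T 0ℓ} {S' : Pred U 0ℓ} (f : T → U) →
                    (∀ {t} → S t → S' (f t)) →
                    (∀ {t t'} → S t → S t' → f t ≡ f t' → t ≡ t') →
                    Small S' → Small S
  small-injection {T} {U} {S} f f-into f-injective S'-small g g-onto =
    S'-small g' λ k → let t , st , gt≡k = g-onto k in f t , f-into st , trans (g'∘f st) gt≡k
    where
    image : U → Pred K 0ℓ
    image u k = ∃ λ t → S t × f t ≡ u × g t ≡ k
    g' : U → K
    g' u = choose k₀ (image u)
    g'∘f : ∀ {t} → S t → g' (f t) ≡ g t
    g'∘f {t} st =
      let t' , st' , ft'≡ft , gt'≡g'ft = choose-spec k₀ {image (f t)} (g t , t , st , refl , refl)
      in trans (sym gt'≡g'ft) (cong g (f-injective st' st ft'≡ft))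

  bounded-small : Infinite K → (N : ℕ) → Small (_<ℕ N)
  bounded-small infinite N g g-onto = infinite (enumeration⇒finite (map g (upTo N)) enumerates)
    where
    enumerates : ∀ k → k ∈ map g (upTo N)
    enumerates k with g-onto k
    ... | i , i<N , refl = ∈-map⁺ g (∈-upTo⁺ i<N)

record CancellativeMagma (K : Set) : Set where
  infixl 7 _∙_
  field
    _∙_ : K → K → K
    ε : K
    identityʳ : RightIdentity _≡_ ε _∙_
    cancelˡ : LeftCancellative _≡_ _∙_
    cancelʳ : RightCancellative _≡_ _∙_

transport : {K L : Set} → K ↔ L → CancellativeMagma L → CancellativeMagma K
transport K↔L M = record
  { _∙_ = λ x y → from (to x ∙ to y)
  ; ε = from ε
  ; identityʳ = λ x → trans (cong (λ z → from (to x ∙ z)) (strictlyInverseˡ ε))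
                            (trans (cong from (identityʳ (to x))) (strictlyInverseʳ x))
  ; cancelˡ = λ x y z eq → to-injective (cancelˡ (to x) (to y) (to z) (from-injective eq))
  ; cancelʳ = λ x y z eq → to-injective (cancelʳ (to x) (to y) (to z) (from-injective eq))
  }
  where
  open CancellativeMagma M
  open Inverse K↔L
  to-injective : ∀ {x y} → to x ≡ to y → x ≡ y
  to-injective {x} {y} eq = trans (sym (strictlyInverseʳ x)) (trans (cong from eq) (strictlyInverseʳ y))
  from-injective : ∀ {x y} → from x ≡ from y → x ≡ y
  from-injective {x} {y} eq = trans (sym (strictlyInverseˡ x)) (trans (cong to eq) (strictlyInverseˡ y))

module _ (m : ℕ) where
  private
    n = suc m

  +-%-cancelˡ : ∀ {a b c} → a ≤ n → b <ℕ n → c <ℕ n → (a + b) % n ≡ (a + c) % n → b ≡ c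
  +-%-cancelˡ {a} {b} {c} a≤n b<n c<n eq = begin
    b                                ≡⟨ sym (undo b<n) ⟩
    (n ∸ a + (a + b)) % n            ≡⟨ %-distribˡ-+ (n ∸ a) (a + b) n ⟩
    ((n ∸ a) % n + (a + b) % n) % n  ≡⟨ cong (λ r → ((n ∸ a) % n + r) % n) eq ⟩
    ((n ∸ a) % n + (a + c) % n) % n  ≡⟨ sym (%-distribˡ-+ (n ∸ a) (a + c) n) ⟩
    (n ∸ a + (a + c)) % n            ≡⟨ undo c<n ⟩
    c                                ∎
    where
    open ≡-Reasoning
    undo : ∀ {x} → x <ℕ n → (n ∸ a + (a + x)) % n ≡ x
    undo {x} x<n = begin
      (n ∸ a + (a + x)) % n  ≡⟨ cong (_% n) (sym (+-assoc (n ∸ a) a x)) ⟩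
      (n ∸ a + a + x) % n    ≡⟨ cong (λ r → (r + x) % n) (m∸n+n≡m a≤n) ⟩
      (n + x) % n            ≡⟨ cong (_% n) (+-comm n x) ⟩
      (x + n) % n            ≡⟨ [m+n]%n≡m%n x n ⟩
      x % n                  ≡⟨ m<n⇒m%n≡m x<n ⟩
      x                      ∎

  cyclicMagma : CancellativeMagma (Fin n)
  cyclicMagma = record
    { _∙_ = _+ₙ_
    ; ε = Fin.zero
    ; identityʳ = λ i → toℕ-injective (trans (toℕ-+ₙ i Fin.zero)
                          (trans (cong (_% n) (+-identityʳ (toℕ i))) (m<n⇒m%n≡m (toℕ<n i))))
    ; cancelˡ = λ i j k eq → toℕ-injective (+-%-cancelˡ (<⇒≤ (toℕ<n i)) (toℕ<n j) (toℕ<n k) (sums i j i k eq))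
    ; cancelʳ = λ i j k eq → toℕ-injective (+-%-cancelˡ (<⇒≤ (toℕ<n i)) (toℕ<n j) (toℕ<n k)
                  (trans (cong (_% n) (+-comm (toℕ i) (toℕ j)))
                         (trans (sums j i k i eq) (cong (_% n) (+-comm (toℕ k) (toℕ i))))))
    }
    where
    _+ₙ_ : Fin n → Fin n → Fin n
    i +ₙ j = (toℕ i + toℕ j) mod n
    toℕ-+ₙ : ∀ i j → toℕ (i +ₙ j) ≡ (toℕ i + toℕ j) % n
    toℕ-+ₙ i j = toℕ-fromℕ< (m%n<n (toℕ i + toℕ j) n)
    sums : ∀ i j k l → i +ₙ j ≡ k +ₙ l → (toℕ i + toℕ j) % n ≡ (toℕ k + toℕ l) % n
    sums i j k l eq = trans (sym (toℕ-+ₙ i j)) (trans (cong toℕ eq) (toℕ-+ₙ k l))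

module MexMagma (em : ExcludedMiddle) {K : Set} (k₀ : K)
                {_≺_ : Rel K 0ℓ} (compare : Trichotomous _≡_ _≺_) (wf : WellFounded _≺_)
                (small : ∀ x y → Smallness.Small em k₀ ((_≺ x) ⟨⊎⟩ (_≺ y))) where
  open Least em compare wf

  Taken : K → K → (K ⊎ K → K) → Pred K 0ℓ
  Taken x y g k = ∃ λ t → ((_≺ x) ⟨⊎⟩ (_≺ y)) t × g t ≡ k

  _⊏_ : Rel (K × K) 0ℓ
  _⊏_ = ×-Lex _≡_ _≺_ _≺_

  -- The entries x' ∙ y (inj₁ x') and x ∙ y' (inj₂ y') already fixed when x ∙ y is defined;
  -- off the segments the value is junk.
  earlier : ∀ x y → WfRec _⊏_ (λ _ → K) (x , y) → K ⊎ K → K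
  earlier x y IH (inj₁ x') with em (x' ≺ x)
  ... | yes x'≺x = IH {x' , y} (inj₁ x'≺x)
  ... | no _ = k₀
  earlier x y IH (inj₂ y') with em (y' ≺ y)
  ... | yes y'≺y = IH (inj₂ (refl , y'≺y))
  ... | no _ = k₀

  step : ∀ p → WfRec _⊏_ (λ _ → K) p → K
  step (x , y) IH = proj₁ (mex (Taken x y (earlier x y IH)) (small x y (earlier x y IH)))

  step-cong : ∀ p {IH IH' : WfRec _⊏_ (λ _ → K) p} → (∀ {q} (q⊏p : q ⊏ p) → IH q⊏p ≡ IH' q⊏p) →
              step p IH ≡ step p IH'
  step-cong (x , y) {IH} {IH'} IH≗IH' =
    mex-cong (small x y (earlier x y IH)) (small x y (earlier x y IH'))
      ( (λ (t , st , eq) → t , st , trans (sym (earlier-cong t)) eq)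
      , (λ (t , st , eq) → t , st , trans (earlier-cong t) eq))
    where
    earlier-cong : ∀ t → earlier x y IH t ≡ earlier x y IH' t
    earlier-cong (inj₁ x') with em (x' ≺ x)
    ... | yes x'≺x = IH≗IH' {x' , y} (inj₁ x'≺x)
    ... | no _ = refl
    earlier-cong (inj₂ y') with em (y' ≺ y)
    ... | yes y'≺y = IH≗IH' {x , y'} (inj₂ (refl , y'≺y))
    ... | no _ = refl

  open WF.All (×-wellFounded wf wf) 0ℓ using (wfRec)
  open WF.FixPoint (×-wellFounded wf wf) (λ _ → K) step step-cong using (unfold-wfRec)

  infixl 7 _∙_
  _∙_ : K → K → K
  x ∙ y = wfRec (λ _ → K) step (x , y)

  earlier-∙ : ∀ x y → K ⊎ K → K
  earlier-∙ x y = earlier x y (λ {q} _ → wfRec (λ _ → K) step q)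

  ∙-mex : ∀ x y → IsLeast (∁ (Taken x y (earlier-∙ x y))) (x ∙ y)
  ∙-mex x y = subst (IsLeast (∁ (Taken x y (earlier-∙ x y)))) (sym (unfold-wfRec {x , y}))
                    (proj₂ (mex (Taken x y (earlier-∙ x y)) (small x y (earlier-∙ x y))))

  earlier-left : ∀ {x' x} y → x' ≺ x → earlier-∙ x y (inj₁ x') ≡ x' ∙ y
  earlier-left {x'} {x} y x'≺x with em (x' ≺ x)
  ... | yes _ = refl
  ... | no x'⊀x = contradiction x'≺x x'⊀x

  earlier-right : ∀ x {y' y} → y' ≺ y → earlier-∙ x y (inj₂ y') ≡ x ∙ y'
  earlier-right x {y'} {y} y'≺y with em (y' ≺ y)
  ... | yes _ = refl
  ... | no y'⊀y = contradiction y'≺y y'⊀y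

  e : K
  e = proj₁ (least (λ _ → ⊤) (k₀ , tt))

  e-least : ∀ {y} → ¬ (y ≺ e)
  e-least y≺e = proj₂ (proj₂ (least (λ _ → ⊤) (k₀ , tt))) y≺e tt

  identityʳ : ∀ x → Acc _≺_ x → x ∙ e ≡ x
  identityʳ x (acc below) = resolve (compare (x ∙ e) x)
    where
    resolve : Tri ((x ∙ e) ≺ x) (x ∙ e ≡ x) (x ≺ (x ∙ e)) → x ∙ e ≡ x
    resolve (tri< xe≺x _ _) =
      contradiction (inj₁ (x ∙ e) , xe≺x , trans (earlier-left e xe≺x) (identityʳ (x ∙ e) (below xe≺x)))
                    (proj₁ (∙-mex x e))
    resolve (tri≈ _ xe≡x _) = xe≡x
    resolve (tri> _ _ x≺xe) = contradiction x-free (proj₂ (∙-mex x e) x≺xe)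
      where
      x-free : ¬ Taken x e (earlier-∙ x e) x
      x-free (inj₁ x' , x'≺x , eq) = tri⇒irr compare refl (subst (_≺ x) x'≡x x'≺x)
        where
        x'≡x : x' ≡ x
        x'≡x = trans (sym (identityʳ x' (below x'≺x))) (trans (sym (earlier-left e x'≺x)) eq)
      x-free (inj₂ y' , y'≺e , _) = e-least y'≺e

  cancelʳ : ∀ x y z → y ∙ x ≡ z ∙ x → y ≡ z
  cancelʳ x = separated⇒injective compare λ {y} {z} y≺z eq →
    proj₁ (∙-mex z x) (inj₁ y , y≺z , trans (earlier-left x y≺z) eq)

  cancelˡ : ∀ x y z → x ∙ y ≡ x ∙ z → y ≡ z
  cancelˡ x = separated⇒injective compare λ {y} {z} y≺z eq →
    proj₁ (∙-mex x z) (inj₂ y , y≺z , trans (earlier-right x y≺z) eq)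

  mexMagma : CancellativeMagma K
  mexMagma = record
    { _∙_ = _∙_ ; ε = e ; identityʳ = λ x → identityʳ x (wf x) ; cancelˡ = cancelˡ ; cancelʳ = cancelʳ }

-- If (below J) × ℕ maps onto K for some J, embed K into it for the least such J; otherwise use
-- x ↦ (x , 0). Either way every s x = (j , n) has (below j) × ℕ small, and in the order pulled
-- back along s two initial segments interleave (even/odd) into one lexicographic segment below
-- some (j , N), which is small (finite when j is least in K).
module InfiniteMagma (em : ExcludedMiddle) {K : Set} (k₀ : K) (infinite : Infinite K)
                     {_<_ : Rel K 0ℓ} (sto : IsStrictTotalOrder _≡_ _<_) (wf : WellFounded _<_) where
  open Classical em
  open Smallness em k₀
  open Least em (IsStrictTotalOrder.compare sto) wf

  _<ₗ_ : Rel (K × ℕ) 0ℓ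
  _<ₗ_ = ×-Lex _≡_ _<_ _<ℕ_

  module Lex = IsStrictTotalOrder (×-isStrictTotalOrder sto <-isStrictTotalOrder)

  Short : K → Set
  Short J = Small {K × ℕ} ((_< J) ∘ proj₁)

  short-embedding : Σ (K → K × ℕ) λ s → Injective _≡_ _≡_ s × (∀ x → Short (proj₁ (s x)))
  short-embedding with em (∃ λ J → ¬ Short J)
  ... | no ∄J = (λ x → x , 0) , cong proj₁ , λ x → dne λ ¬short → ∄J (x , ¬short)
  ... | yes ∃J = s , s-injective , s-short
    where
    J = proj₁ (least (∁ Short) ∃J)
    J-least = proj₂ (least (∁ Short) ∃J)
    onto : ∃ λ (g : K × ℕ → K) → ∀ k → ∃ λ t → proj₁ t < J × g t ≡ k
    onto = dne λ ∄g → proj₁ J-least λ g g-onto → ∄g (g , g-onto)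
    g = proj₁ onto
    s : K → K × ℕ
    s k = proj₁ (proj₂ onto k)
    g∘s : ∀ k → g (s k) ≡ k
    g∘s k = proj₂ (proj₂ (proj₂ onto k))
    s-injective : Injective _≡_ _≡_ s
    s-injective {x} {y} sx≡sy = trans (sym (g∘s x)) (trans (cong g sx≡sy) (g∘s y))
    s-short : ∀ x → Short (proj₁ (s x))
    s-short x = dne (proj₂ J-least (proj₁ (proj₂ (proj₂ onto x))))

  even odd : K × ℕ → K × ℕ
  even (a , i) = a , 2 * i
  odd (a , i) = a , suc (2 * i)

  even-injective : ∀ {p q} → even p ≡ even q → p ≡ q
  even-injective {_ , i} {_ , j} eq = cong₂ _,_ (cong proj₁ eq) (*-cancelˡ-≡ i j 2 (cong proj₂ eq))

  odd-injective : ∀ {p q} → odd p ≡ odd q → p ≡ q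
  odd-injective {_ , i} {_ , j} eq =
    cong₂ _,_ (cong proj₁ eq) (*-cancelˡ-≡ i j 2 (suc-injective (cong proj₂ eq)))

  even≢odd′ : ∀ {p q} → even p ≢ odd q
  even≢odd′ {_ , i} {_ , j} eq = even≢odd i j (cong proj₂ eq)

  even-mono : ∀ {p q} → p <ₗ q → even p <ₗ even q
  even-mono (inj₁ a<b) = inj₁ a<b
  even-mono (inj₂ (a≡b , i<j)) = inj₂ (a≡b , *-monoʳ-< 2 i<j)

  odd-mono : ∀ {p q} → p <ₗ q → odd p <ₗ odd q
  odd-mono (inj₁ a<b) = inj₁ a<b
  odd-mono (inj₂ (a≡b , i<j)) = inj₂ (a≡b , s<s (*-monoʳ-< 2 i<j))

  short-segment-small : ∀ {J} → Short J → ∀ N → Small (_<ₗ (J , N))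
  short-segment-small {J} short N with em (∃ (_< J))
  ... | yes (j₀ , j₀<J) = small-injection squeeze into injective short
    where
    squeeze : K × ℕ → K × ℕ
    squeeze (a , i) with em (a < J)
    ... | yes _ = even (a , i)
    ... | no _ = odd (j₀ , i)
    into : ∀ {t} → t <ₗ (J , N) → proj₁ (squeeze t) < J
    into {a , i} _ with em (a < J)
    ... | yes a<J = a<J
    ... | no _ = j₀<J
    top : ∀ {a i} → (a , i) <ₗ (J , N) → ¬ a < J → a ≡ J
    top (inj₁ a<J) a≮J = contradiction a<J a≮J
    top (inj₂ (a≡J , _)) _ = a≡J
    injective : ∀ {t t'} → t <ₗ (J , N) → t' <ₗ (J , N) → squeeze t ≡ squeeze t' → t ≡ t'
    injective {a , i} {a' , i'} t<JN t'<JN eq with em (a < J) | em (a' < J)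
    ... | yes _ | yes _ = even-injective eq
    ... | yes _ | no _ = contradiction eq (even≢odd′ {a , i} {j₀ , i'})
    ... | no _ | yes _ = contradiction (sym eq) (even≢odd′ {a' , i'} {j₀ , i})
    ... | no a≮J | no a'≮J =
      cong₂ _,_ (trans (top t<JN a≮J) (sym (top t'<JN a'≮J))) (cong proj₂ (odd-injective eq))
  ... | no ∄j = small-injection proj₂ bounded injective (bounded-small infinite N)
    where
    bounded : ∀ {t} → t <ₗ (J , N) → proj₂ t <ℕ N
    bounded (inj₁ a<J) = ⊥-elim (∄j (_ , a<J))
    bounded (inj₂ (_ , i<N)) = i<N
    top : ∀ {a i} → (a , i) <ₗ (J , N) → a ≡ J
    top (inj₁ a<J) = ⊥-elim (∄j (_ , a<J))
    top (inj₂ (a≡J , _)) = a≡J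
    injective : ∀ {t t'} → t <ₗ (J , N) → t' <ₗ (J , N) → proj₂ t ≡ proj₂ t' → t ≡ t'
    injective t<JN t'<JN eq = cong₂ _,_ (trans (top t<JN) (sym (top t'<JN))) eq

  lex-max : ∀ p q → ∃ λ m → (m ≡ p ⊎ m ≡ q) × (∀ {r} → r <ₗ p → r <ₗ m) × (∀ {r} → r <ₗ q → r <ₗ m)
  lex-max p q with Lex.compare p q
  ... | tri< p<q _ _ = q , inj₂ refl , (λ r<p → Lex.trans r<p p<q) , (λ r<q → r<q)
  ... | tri≈ _ p≈q _ = q , inj₂ refl , (λ r<p → subst (_ <ₗ_) (≡×≡⇒≡ p≈q) r<p) , (λ r<q → r<q)
  ... | tri> _ _ q<p = p , inj₁ refl , (λ r<p → r<p) , (λ r<q → Lex.trans r<q q<p)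

  private
    s = proj₁ short-embedding
    s-injective = proj₁ (proj₂ short-embedding)
    s-short = proj₂ (proj₂ short-embedding)

  _≺_ : Rel K 0ℓ
  x ≺ y = s x <ₗ s y

  ≺-compare : Trichotomous _≡_ _≺_
  ≺-compare x y with Lex.compare (s x) (s y)
  ... | tri< sx<sy sx≉sy sy≮sx = tri< sx<sy (λ x≡y → sx≉sy (≡⇒≡×≡ (cong s x≡y))) sy≮sx
  ... | tri≈ sx≮sy sx≈sy sy≮sx = tri≈ sx≮sy (s-injective (≡×≡⇒≡ sx≈sy)) sy≮sx
  ... | tri> sx≮sy sx≉sy sy<sx = tri> sx≮sy (λ x≡y → sx≉sy (≡⇒≡×≡ (cong s x≡y))) sy<sx

  segment-pairs-small : ∀ x y → Small ((_≺ x) ⟨⊎⟩ (_≺ y))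
  segment-pairs-small x y =
    small-injection interleave (λ {t} → into {t}) (λ _ _ → interleave-injective)
                    (short-segment-small m-short (proj₂ m))
    where
    interleave : K ⊎ K → K × ℕ
    interleave (inj₁ z) = even (s z)
    interleave (inj₂ z) = odd (s z)
    interleave-injective : ∀ {t t'} → interleave t ≡ interleave t' → t ≡ t'
    interleave-injective {inj₁ z} {inj₁ z'} eq = cong inj₁ (s-injective (even-injective eq))
    interleave-injective {inj₁ z} {inj₂ z'} eq = contradiction eq (even≢odd′ {s z} {s z'})
    interleave-injective {inj₂ z} {inj₁ z'} eq = contradiction (sym eq) (even≢odd′ {s z'} {s z})
    interleave-injective {inj₂ z} {inj₂ z'} eq = cong inj₂ (s-injective (odd-injective eq))
    bound = lex-max (even (s x)) (odd (s y))
    m = proj₁ bound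
    m-short : Short (proj₁ m)
    m-short with proj₁ (proj₂ bound)
    ... | inj₁ m≡ = subst (Short ∘ proj₁) (sym m≡) (s-short x)
    ... | inj₂ m≡ = subst (Short ∘ proj₁) (sym m≡) (s-short y)
    into : ∀ {t} → ((_≺ x) ⟨⊎⟩ (_≺ y)) t → interleave t <ₗ m
    into {inj₁ z} z≺x = proj₁ (proj₂ (proj₂ bound)) (even-mono z≺x)
    into {inj₂ z} z≺y = proj₂ (proj₂ (proj₂ bound)) (odd-mono z≺y)

  infiniteMagma : CancellativeMagma K
  infiniteMagma = MexMagma.mexMagma em k₀ ≺-compare (On.wellFounded s (×-wellFounded wf <-wellFounded))
                                    segment-pairs-small

cancellativeMagma : ExcludedMiddle → WellOrderingPrinciple → {K : Set} → K → CancellativeMagma K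
cancellativeMagma em wop {K} k₀ with em (Σ ℕ λ n → K ↔ Fin n)
... | yes (zero , K↔Fin0) with () ← Inverse.to K↔Fin0 k₀
... | yes (suc n , K↔Fin) = transport K↔Fin (cyclicMagma n)
... | no infinite = InfiniteMagma.infiniteMagma em k₀ infinite (proj₁ (proj₂ (wop K))) (proj₂ (proj₂ (wop K)))

module OrderedProducts (em : ExcludedMiddle) {K : Set} (M : CancellativeMagma K) {X : Set} where
  open CancellativeMagma M
  open Classical em

  Π : K → (X → K) → List X → K
  Π p c = foldl (λ q x → q ∙ c x) p

  Π-cong : ∀ {p c c'} xs → (∀ {x} → x ∈ xs → c x ≡ c' x) → Π p c xs ≡ Π p c' xs
  Π-cong [] _ = refl
  Π-cong {p} {c} {c'} (x ∷ xs) c≗c' =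
    trans (cong (λ k → Π (p ∙ k) c xs) (c≗c' (here refl))) (Π-cong xs (c≗c' ∘ there))

  Π-cancelʳ : ∀ {p q} c xs → Π p c xs ≡ Π q c xs → p ≡ q
  Π-cancelʳ c [] eq = eq
  Π-cancelʳ {p} {q} c (x ∷ xs) eq = cancelʳ (c x) p q (Π-cancelʳ c xs eq)

  Π-separates : ∀ {p c c' b xs} → AllPairs _≢_ xs → b ∈ xs → (∀ {x} → x ≢ b → c x ≡ c' x) → c b ≢ c' b →
                Π p c xs ≢ Π p c' xs
  Π-separates {p} {c} {c'} {xs = x ∷ xs} (x∉xs ∷ _) (here refl) agree differ eq =
    differ (cancelˡ p (c x) (c' x) (Π-cancelʳ c xs (trans eq (sym (Π-cong xs later-agree)))))
    where
    later-agree : ∀ {z} → z ∈ xs → c z ≡ c' z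
    later-agree z∈xs = agree (λ z≡x → All.lookup x∉xs z∈xs (sym z≡x))
  Π-separates {p} {c} {c'} {xs = x ∷ xs} (x∉xs ∷ unique) (there b∈xs) agree differ eq =
    Π-separates unique b∈xs agree differ
      (trans eq (cong (λ k → Π (p ∙ k) c' xs) (sym (agree (All.lookup x∉xs b∈xs)))))

  Nontrivial : (X → K) → X → Set
  Nontrivial c x = c x ≢ ε

  nontrivial? : (c : X → K) → Decidable (Nontrivial c)
  nontrivial? c x = ¬? (c x ≟ ε)

  Π-nontrivial : ∀ {p} c xs → Π p c xs ≡ Π p c (filter (nontrivial? c) xs)
  Π-nontrivial c [] = refl
  Π-nontrivial {p} c (x ∷ xs) with c x ≟ ε
  ... | yes cx≡ε = trans (cong (λ q → Π q c xs) (trans (cong (p ∙_) cx≡ε) (identityʳ p))) (Π-nontrivial c xs)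
  ... | no _ = Π-nontrivial c xs

module StrictlySorted {X : Set} {_<_ : Rel X 0ℓ} (sto : IsStrictTotalOrder _≡_ _<_) where
  open IsStrictTotalOrder sto using (compare; irrefl; asym) renaming (trans to <-trans)

  Sorted : List X → Set
  Sorted = AllPairs _<_

  insert : X → List X → List X
  insert y [] = y ∷ []
  insert y (x ∷ xs) with compare y x
  ... | tri< _ _ _ = y ∷ x ∷ xs
  ... | tri≈ _ _ _ = x ∷ xs
  ... | tri> _ _ _ = x ∷ insert y xs

  insert-all : ∀ {P : X → Set} {y} xs → P y → All P xs → All P (insert y xs)
  insert-all [] py [] = py ∷ []
  insert-all {y = y} (x ∷ xs) py (px ∷ pxs) with compare y x
  ... | tri< _ _ _ = py ∷ px ∷ pxs
  ... | tri≈ _ _ _ = px ∷ pxs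
  ... | tri> _ _ _ = px ∷ insert-all xs py pxs

  insert-sorted : ∀ {y} xs → Sorted xs → Sorted (insert y xs)
  insert-sorted [] [] = [] ∷ []
  insert-sorted {y} (x ∷ xs) (x<xs ∷ sorted) with compare y x
  ... | tri< y<x _ _ = (y<x ∷ All.map (<-trans y<x) x<xs) ∷ x<xs ∷ sorted
  ... | tri≈ _ _ _ = x<xs ∷ sorted
  ... | tri> _ _ x<y = insert-all xs x<y x<xs ∷ insert-sorted xs sorted

  ∈-insert : ∀ {y z} xs → z ≡ y ⊎ z ∈ xs → z ∈ insert y xs
  ∈-insert [] (inj₁ z≡y) = here z≡y
  ∈-insert {y} (x ∷ xs) z∈ with compare y x
  ∈-insert (x ∷ xs) (inj₁ z≡y) | tri< _ _ _ = here z≡y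
  ∈-insert (x ∷ xs) (inj₂ z∈) | tri< _ _ _ = there z∈
  ∈-insert (x ∷ xs) (inj₁ z≡y) | tri≈ _ y≡x _ = here (trans z≡y y≡x)
  ∈-insert (x ∷ xs) (inj₂ z∈) | tri≈ _ _ _ = z∈
  ∈-insert (x ∷ xs) (inj₁ z≡y) | tri> _ _ _ = there (∈-insert xs (inj₁ z≡y))
  ∈-insert (x ∷ xs) (inj₂ (here z≡x)) | tri> _ _ _ = here z≡x
  ∈-insert (x ∷ xs) (inj₂ (there z∈)) | tri> _ _ _ = there (∈-insert xs (inj₂ z∈))

  sort : List X → List X
  sort = foldr insert []

  sort-sorted : ∀ xs → Sorted (sort xs)
  sort-sorted [] = []
  sort-sorted (x ∷ xs) = insert-sorted (sort xs) (sort-sorted xs)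

  ∈-sort : ∀ {z} xs → z ∈ xs → z ∈ sort xs
  ∈-sort (x ∷ xs) (here z≡x) = ∈-insert (sort xs) (inj₁ z≡x)
  ∈-sort (x ∷ xs) (there z∈) = ∈-insert (sort xs) (inj₂ (∈-sort xs z∈))

  sorted⇒unique : ∀ {xs} → Sorted xs → AllPairs _≢_ xs
  sorted⇒unique = AllPairs.map λ x<y x≡y → irrefl x≡y x<y

  sorted-heads : ∀ {x y xs ys} → All (x <_) xs → All (y <_) ys → x ∈ y ∷ ys → y ∈ x ∷ xs → x ≡ y
  sorted-heads _ _ (here x≡y) _ = x≡y
  sorted-heads _ _ (there _) (here y≡x) = sym y≡x
  sorted-heads x<xs y<ys (there x∈ys) (there y∈xs) =
    contradiction (All.lookup y<ys x∈ys) (asym (All.lookup x<xs y∈xs))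

  sorted-tails : ∀ {x xs ys} → All (x <_) xs → (∀ {z} → z ∈ xs → z ∈ x ∷ ys) → ∀ {z} → z ∈ xs → z ∈ ys
  sorted-tails x<xs xs⊆ z∈xs with xs⊆ z∈xs
  ... | here z≡x = contradiction (All.lookup x<xs z∈xs) (irrefl (sym z≡x))
  ... | there z∈ys = z∈ys

  sorted-extensional : ∀ {xs ys} → Sorted xs → Sorted ys →
                       (∀ {z} → z ∈ xs → z ∈ ys) → (∀ {z} → z ∈ ys → z ∈ xs) → xs ≡ ys
  sorted-extensional {[]} {[]} _ _ _ _ = refl
  sorted-extensional {[]} {y ∷ ys} _ _ _ ys⊆ with () ← ys⊆ (here refl)
  sorted-extensional {x ∷ xs} {[]} _ _ xs⊆ _ with () ← xs⊆ (here refl)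
  sorted-extensional {x ∷ xs} {y ∷ ys} (x<xs ∷ sxs) (y<ys ∷ sys) xs⊆ ys⊆
    with refl ← sorted-heads x<xs y<ys (xs⊆ (here refl)) (ys⊆ (here refl))
    = cong (x ∷_) (sorted-extensional sxs sys (sorted-tails x<xs (xs⊆ ∘ there))
                                              (sorted-tails y<ys (ys⊆ ∘ there)))

record HammingColouring (X K : Set) : Set where
  field
    colour : (X → K) → K
    colour-cong : ∀ {f g} → f ≗ g → colour f ≡ colour g
    colour-separates : ∀ {f g} b → (∀ {x} → x ≢ b → f x ≡ g x) → f b ≢ g b → colour f ≢ colour g

module HammingConstruction (em : ExcludedMiddle) {X K : Set} (M : CancellativeMagma K)
         {_<_ : Rel X 0ℓ} (sto : IsStrictTotalOrder _≡_ _<_)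
         {_⊲_ : Rel (X → K) 0ℓ} (compare : Trichotomous _≡_ _⊲_) (wf : WellFounded _⊲_) where
  open Classical em
  open CancellativeMagma M
  open OrderedProducts em M
  open StrictlySorted sto
  open Least em compare wf
  open ≡-Reasoning

  Π-sorted-invariant : ∀ {p c xs ys} → Sorted xs → Sorted ys →
                       (∀ {x} → Nontrivial c x → x ∈ xs) → (∀ {x} → Nontrivial c x → x ∈ ys) →
                       Π p c xs ≡ Π p c ys
  Π-sorted-invariant {p} {c} {xs} {ys} sorted-xs sorted-ys xs⊇ ys⊇ = begin
    Π p c xs                           ≡⟨ Π-nontrivial c xs ⟩
    Π p c (filter (nontrivial? c) xs)  ≡⟨ cong (Π p c) (sorted-extensional
                                            (AllPairsₚ.filter⁺ (nontrivial? c) sorted-xs)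
                                            (AllPairsₚ.filter⁺ (nontrivial? c) sorted-ys)
                                            (restrict xs ys⊇) (restrict ys xs⊇)) ⟩
    Π p c (filter (nontrivial? c) ys)  ≡⟨ sym (Π-nontrivial c ys) ⟩
    Π p c ys                           ∎
    where
    restrict : ∀ vs {ws} → (∀ {x} → Nontrivial c x → x ∈ ws) →
               ∀ {z} → z ∈ filter (nontrivial? c) vs → z ∈ filter (nontrivial? c) ws
    restrict vs ws⊇ z∈ =
      let _ , nz = ∈-filter⁻ (nontrivial? c) {xs = vs} z∈ in ∈-filter⁺ (nontrivial? c) (ws⊇ nz) nz

  _=*_ : Rel (X → K) 0ℓ
  f =* g = ∃ λ L → ∀ {x} → f x ≢ g x → x ∈ L

  =*-refl : ∀ {f} → f =* f
  =*-refl = [] , λ f≢f → contradiction refl f≢f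

  =*-sym : ∀ {f g} → f =* g → g =* f
  =*-sym (L , cover) = L , λ g≢f → cover (g≢f ∘ sym)

  =*-trans : ∀ {f g h} → f =* g → g =* h → f =* h
  =*-trans {f} {g} {h} (L , cover) (L' , cover') = L ++ L' , through
    where
    through : ∀ {x} → f x ≢ h x → x ∈ L ++ L'
    through {x} f≢h with f x ≟ g x
    ... | yes f≡g = ∈-++⁺ʳ L (cover' λ g≡h → f≢h (trans f≡g g≡h))
    ... | no f≢g = ∈-++⁺ˡ (cover f≢g)

  private
    closest : (f : X → K) → ∃ (IsLeast (f =*_))
    closest f = least (f =*_) (f , =*-refl {f})

  rep : (X → K) → (X → K)
  rep f = proj₁ (closest f)

  rep-near : ∀ f → f =* rep f
  rep-near f = proj₁ (proj₂ (closest f))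

  rep-cong : ∀ {f g} → f =* g → rep f ≡ rep g
  rep-cong f=*g = least-unique (=*-trans (=*-sym f=*g) , =*-trans f=*g) (proj₂ (closest _)) (proj₂ (closest _))

  digit : (X → K) → (X → K) → X → K
  digit r f x = transpose (r x) ε (f x)

  digit-nontrivial : ∀ {r f x} → Nontrivial (digit r f) x → f x ≢ r x
  digit-nontrivial {r} {f} {x} nontrivial fx≡rx =
    nontrivial (trans (cong (transpose (r x) ε) fx≡rx) (transpose-self (r x) ε))

  support : (X → K) → List X
  support f = sort (proj₁ (rep-near f))

  colour : (X → K) → K
  colour f = Π ε (digit (rep f) f) (support f)

  colour-on : ∀ f {ys} → Sorted ys → (∀ {x} → f x ≢ rep f x → x ∈ ys) → colour f ≡ Π ε (digit (rep f) f) ys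
  colour-on f sorted-ys ys⊇ =
    Π-sorted-invariant (sort-sorted (proj₁ (rep-near f))) sorted-ys
      (λ nontrivial → ∈-sort (proj₁ (rep-near f)) (proj₂ (rep-near f) (differs nontrivial)))
      (λ nontrivial → ys⊇ (differs nontrivial))
    where
    differs : ∀ {x} → Nontrivial (digit (rep f) f) x → f x ≢ rep f x
    differs = digit-nontrivial {rep f} {f}

  colour-cong : ∀ {f g} → f ≗ g → colour f ≡ colour g
  colour-cong {f} {g} f≗g = begin
    colour f                           ≡⟨ Π-cong {c = digit (rep f) f} {c' = digit (rep g) g} (support f)
                                            (λ {x} _ → cong₂ (λ r k → transpose r ε k)
                                                             (cong (_$ x) rep≡) (f≗g x)) ⟩
    Π ε (digit (rep g) g) (support f)  ≡⟨ sym (colour-on g (sort-sorted (proj₁ (rep-near f))) covered) ⟩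
    colour g                           ∎
    where
    rep≡ : rep f ≡ rep g
    rep≡ = rep-cong ([] , λ f≢g → contradiction (f≗g _) f≢g)
    covered : ∀ {x} → g x ≢ rep g x → x ∈ support f
    covered {x} g≢r = ∈-sort (proj₁ (rep-near f)) (proj₂ (rep-near f) λ f≡r →
      g≢r (trans (sym (f≗g x)) (trans f≡r (cong (_$ x) rep≡))))

  colour-separates : ∀ {f g} b → (∀ {x} → x ≢ b → f x ≡ g x) → f b ≢ g b → colour f ≢ colour g
  colour-separates {f} {g} b agree differ eq =
    Π-separates (sorted⇒unique (sort-sorted Ls)) b∈zs (λ {x} x≢b → cong (transpose (r x) ε) (agree x≢b))
                (differ ∘ transpose-injective (r b) ε) (begin
      Π ε (digit r f) zs        ≡⟨ sym (colour-on f (sort-sorted Ls) cover-f) ⟩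
      colour f                  ≡⟨ eq ⟩
      colour g                  ≡⟨ colour-on g (sort-sorted Ls) cover-g ⟩
      Π ε (digit (rep g) g) zs  ≡⟨ cong (λ r' → Π ε (digit r' g) zs) (sym rep≡) ⟩
      Π ε (digit r g) zs        ∎)
    where
    r = rep f
    rep≡ : rep f ≡ rep g
    rep≡ = rep-cong ((b ∷ []) , λ f≢g → here (dne λ x≢b → f≢g (agree x≢b)))
    Ls = proj₁ (rep-near f) ++ proj₁ (rep-near g) ++ b ∷ []
    zs = sort Ls
    cover-f : ∀ {x} → f x ≢ rep f x → x ∈ zs
    cover-f f≢r = ∈-sort Ls (∈-++⁺ˡ (proj₂ (rep-near f) f≢r))
    cover-g : ∀ {x} → g x ≢ rep g x → x ∈ zs
    cover-g g≢r = ∈-sort Ls (∈-++⁺ʳ (proj₁ (rep-near f)) (∈-++⁺ˡ (proj₂ (rep-near g) g≢r)))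
    b∈zs : b ∈ zs
    b∈zs = ∈-sort Ls (∈-++⁺ʳ (proj₁ (rep-near f)) (∈-++⁺ʳ (proj₁ (rep-near g)) (here refl)))

  hamming : HammingColouring X K
  hamming = record { colour = colour ; colour-cong = colour-cong ; colour-separates = colour-separates }

hammingColouring : ExcludedMiddle → WellOrderingPrinciple → {X K : Set} → K → HammingColouring X K
hammingColouring em wop {X} {K} k₀ =
  HammingConstruction.hamming em (cancellativeMagma em wop k₀) (proj₁ (proj₂ (wop X)))
    (IsStrictTotalOrder.compare (proj₁ (proj₂ (wop (X → K))))) (proj₂ (proj₂ (wop (X → K))))

module HatGame (em : ExcludedMiddle) {A K : Set} (V : A → A → Bool) (In : Inning A)
               (s1 : S1 In) (s2 : S2 In V) (H : HammingColouring A K) (k₁ : K) where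
  open Inning In
  open Classical em
  open HammingColouring H

  a₀ : A
  a₀ = proj₁ s1

  a₀-heard : ∀ {a} → a ≢ a₀ → Heard a a₀
  a₀-heard {a} a≢a₀ with IsStrictTotalOrder.compare isSTO (I a₀) (I a)
  ... | tri< a₀<a _ _ = a₀<a
  ... | tri≈ _ Ia₀≡Ia _ = contradiction (proj₂ (proj₂ s1) a first) a≢a₀
    where
    first : InFirst a
    first b b<a = proj₁ (proj₂ s1) b (subst (I b <_) (sym Ia₀≡Ia) b<a)
  ... | tri> _ _ a<a₀ = contradiction a<a₀ (proj₁ (proj₂ s1) a)

  colour₀ : (A → K) → K
  colour₀ g = colour (g [ a₀ ≔ k₁ ])

  reset-cong : ∀ {f g x} → (x ≢ a₀ → f x ≡ g x) → (f [ a₀ ≔ k₁ ]) x ≡ (g [ a₀ ≔ k₁ ]) x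
  reset-cong {x = x} agree with x ≟ a₀
  ... | yes _ = refl
  ... | no x≢a₀ = agree x≢a₀

  colour₀-cong : ∀ {f g} → (∀ {x} → x ≢ a₀ → f x ≡ g x) → colour₀ f ≡ colour₀ g
  colour₀-cong agree = colour-cong λ _ → reset-cong agree

  colour₀-separates : ∀ {f g} b → b ≢ a₀ → (∀ {x} → x ≢ a₀ → x ≢ b → f x ≡ g x) → f b ≢ g b →
                      colour₀ f ≢ colour₀ g
  colour₀-separates {f} {g} b b≢a₀ agree differ =
    colour-separates b (λ x≢b → reset-cong (λ x≢a₀ → agree x≢a₀ x≢b))
      λ eq → differ (trans (sym ([≔]-other f k₁ b≢a₀)) (trans eq ([≔]-other g k₁ b≢a₀)))

  view : (a : A) → ((b : A) → Heard a b → K) → ((b : A) → V a b ≡ true → K) → A → K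
  view a heard seen b with V a b ≟ᵇ true | em (Heard a b)
  ... | yes visible | _ = seen b visible
  ... | no _ | yes hears = heard b hears
  ... | no _ | no _ = k₁

  strategies : Strategies In K V
  strategies a heard seen with a ≟ a₀
  ... | yes _ = colour₀ (view a heard seen)
  ... | no a≢a₀ = choose k₁ λ c → colour₀ (view a heard seen [ a ≔ c ]) ≡ heard a₀ (a₀-heard a≢a₀)

  predictor : (A → K) → (A → K)
  predictor f a with a ≟ a₀
  ... | yes _ = colour₀ f
  ... | no _ = f a

  predictor-a₀ : ∀ f → predictor f a₀ ≡ colour₀ f
  predictor-a₀ f with a₀ ≟ a₀
  ... | yes _ = refl
  ... | no a₀≢a₀ = contradiction refl a₀≢a₀

  predictor-other : ∀ f {a} → a ≢ a₀ → predictor f a ≡ f a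
  predictor-other f {a} a≢a₀ with a ≟ a₀
  ... | yes a≡a₀ = contradiction a≡a₀ a≢a₀
  ... | no _ = refl

  view-correct : ∀ f a {b} → b ≢ a → b ≢ a₀ → view a (λ b _ → predictor f b) (λ b _ → f b) b ≡ f b
  view-correct f a {b} b≢a b≢a₀ with V a b ≟ᵇ true | em (Heard a b)
  ... | yes _ | _ = refl
  ... | no _ | yes _ = predictor-other f b≢a₀
  ... | no invisible | no ¬hears with proj₁ (s2 a b) b≢a
  ...   | inj₁ visible = contradiction visible invisible
  ...   | inj₂ hears = contradiction hears ¬hears

  chosen-correct : ∀ f {a} (a≢a₀ : a ≢ a₀) →
    choose k₁ (λ c → colour₀ (view a (λ b _ → predictor f b) (λ b _ → f b) [ a ≔ c ]) ≡ predictor f a₀) ≡ f a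
  chosen-correct f {a} a≢a₀ = dne λ c≢fa →
    colour₀-separates a a≢a₀ (λ x≢a₀ x≢a → trans ([≔]-other w c x≢a) (view-correct f a x≢a x≢a₀))
      (λ eq → c≢fa (trans (sym ([≔]-updated w a c)) eq))
      (trans (choose-spec k₁ {Consistent} (f a , trans (colour₀-cong fa-consistent) (sym (predictor-a₀ f))))
             (predictor-a₀ f))
    where
    w = view a (λ b _ → predictor f b) (λ b _ → f b)
    Consistent : K → Set
    Consistent c = colour₀ (w [ a ≔ c ]) ≡ predictor f a₀
    c = choose k₁ Consistent
    fa-consistent : ∀ {x} → x ≢ a₀ → (w [ a ≔ f a ]) x ≡ f x
    fa-consistent {x} x≢a₀ = [≔]-restore a x λ x≢a → view-correct f a x≢a x≢a₀

  isPredictor : IsPredictor In K V predictor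
  isPredictor = strategies , follows
    where
    follows : ∀ f a → predictor f a ≡ strategies a (λ b _ → predictor f b) (λ b _ → f b)
    follows f a with a ≟ a₀
    ... | yes refl = colour₀-cong λ b≢a₀ → sym (view-correct f a b≢a₀ b≢a₀)
    ... | no a≢a₀ = sym (chosen-correct f a≢a₀)

  atMostOneWrong : AtMostOneWrong In K predictor
  atMostOneWrong f a b wrong-a wrong-b = trans (only-a₀ wrong-a) (sym (only-a₀ wrong-b))
    where
    only-a₀ : ∀ {x} → predictor f x ≢ f x → x ≡ a₀
    only-a₀ wrong = dne λ x≢a₀ → wrong (predictor-other f x≢a₀)

corollary5p4 : AxiomOfChoice → (A K : Set) → Infinite A → AtLeastTwo K
    → (V : A → A → Bool) → (∀ a → V a a ≡ false)
    → (In : Inning A) → AtLeastTwoInnings In → S1 In → S2 In V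
    → Σ ((A → K) → (A → K)) λ P → IsPredictor In K V P × AtMostOneWrong In K P
corollary5p4 (em , wop) A K _ (k₁ , _) V _ In _ s1 s2 = predictor , isPredictor , atMostOneWrong
  where open HatGame em V In s1 s2 (hammingColouring em wop k₁) k₁
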